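{- For every integer $d\ge 2$, $\mu(\mathit{BF}(d))\le 2^{d+1}-2$.
   Context: For a connected graph $G$ and $X\subseteq V(G)$, two vertices $x,y\in V(G)$ are $X$-visible if there is a shortest $x,y$-path none of whose internal vertices lies in $X$. $X$ is a mutual-visibility set if every two vertices of $X$ are $X$-visible; $\mu(G)$ is the maximum cardinality of a mutual-visibility set of $G$. The $d$-dimensional butterfly $\mathit{BF}(d)$ has vertex set $\{[\ell,c] : \ell\in\{0,1,\dots,d\},\ c\in\{0,1\}^d\}$ ($\ell$ is the level, $c$ the column); for $\ell\in\{1,\dots,d\}$, the vertex $[\ell-1,c]$ is adjacent to $[\ell,c']$ if and only if either $c=c'$ or $c$ and $c'$ differ exactly in the $\ell$-th bit (bits counted from the left starting at 1); there are no other edges. -}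

module Defs where

open import Data.Nat using (ℕ; zero; suc; _≤_)
open import Data.Fin using (Fin; inject₁) renaming (suc to fsuc)
open import Data.Vec using (Vec; _[_]%=_)
open import Data.Bool using (Bool; not)
open import Data.Product using (_×_; _,_; ∃-syntax)
open import Data.Sum using (_⊎_)
open import Data.List using (List; []; _∷_)
open import Data.List.Relation.Unary.All using (All)
open import Data.List.Membership.Propositional using (_∈_)
open import Relation.Nullary using (¬_)

module _ {V : Set} (Adj : V → V → Set) where

  data Walk : V → V → Set where
    nil  : ∀ {x} → Walk x x
    cons : ∀ {x y z} → Adj x y → Walk y z → Walk x z

  len : ∀ {x y} → Walk x y → ℕ
  len nil        = 0
  len (cons _ w) = suc (len w)

  interior : ∀ {x y} → Walk x y → List V
  interior nil                        = []
  interior (cons _ nil)               = []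
  interior (cons {y = v} _ (cons a w)) = v ∷ interior (cons a w)

  IsShortest : ∀ {x y} → Walk x y → Set
  IsShortest {x} {y} w = (w' : Walk x y) → len w ≤ len w'

  Visible : List V → V → V → Set
  Visible X x y =
    ∃[ w ] (IsShortest {x} {y} w × All (λ v → ¬ (v ∈ X)) (interior w))

  MutualVisibility : List V → Set
  MutualVisibility X = ∀ {x y} → x ∈ X → y ∈ X → Visible X x y

-- The d-dimensional butterfly BF(d).
-- Vertex [ℓ , c] with level ℓ ∈ {0..d} and column c ∈ {0,1}^d.

BFVertex : ℕ → Set
BFVertex d = Fin (suc d) × Vec Bool d

-- Edges between level ℓ-1 and level ℓ (ℓ = 1..d); here l : Fin d stands
-- for ℓ-1, so bit number ℓ (1-based from the left) is index l (0-based).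
data BFDown (d : ℕ) : BFVertex d → BFVertex d → Set where
  straight : (l : Fin d) (c : Vec Bool d) →
             BFDown d (inject₁ l , c) (fsuc l , c)
  cross    : (l : Fin d) (c : Vec Bool d) →
             BFDown d (inject₁ l , c) (fsuc l , c [ l ]%= not)

BFAdj : (d : ℕ) → BFVertex d → BFVertex d → Set
BFAdj d u v = BFDown d u v ⊎ BFDown d v u

module Submission where

-- For F ∈ {0,1}^d let key F [ℓ,c] be c with its bits below ℓ xored with F.  The vertices of a
-- common key form an F-line, a geodesic from level 0 to level d; the 2^d F-lines partition BF(d),
-- and for F = 0 they are the columns.  A mutual-visibility set X has at most two points on a line,
-- since the middle one of three lies on every shortest path between the other two.  So if some F
-- has two deficient lines (with fewer than two points of X), then |X| ≤ 2^(d+1) − 2.  Otherwise X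
-- is labelled injectively by the 2^d words F and two extra labels, whence |X| ≤ 2^d + 2, which is
-- below 2^(d+1) − 1 for d ≥ 2.  A point alone on its F-line gets label F (injectively, since that
-- line is the only deficient F-line).  Any other point x is the top or the bottom of a column of
-- two points; say the top.  If flipping the first bit leads to a deficient column, x gets the
-- extra label "top".  Otherwise a shortest path from x to a point of that column changes the
-- first bit, hence passes level 0 and then ascends to x, and the line through x and that level-0
-- vertex carries no other point of X.

open import Data.Bool using (Bool; true; false; not; _xor_)
open import Data.Bool.Properties as Bool using (xor-same; xor-assoc; xor-identityʳ; not-involutive)
open import Data.Empty using (⊥; ⊥-elim)
open import Data.Fin using (Fin; toℕ; inject₁; fromℕ; lower₁) renaming (zero to fzero; suc to fsuc)
open import Data.Fin.Properties as Fin using (toℕ-inject₁; toℕ-injective; toℕ<n; toℕ-fromℕ; inject₁-lower₁)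
open import Data.List using (List; []; _∷_; length; map; _++_)
open import Data.List.Properties using (length-map; length-++)
open import Data.List.Membership.Propositional using (_∈_; _∉_; find; lose)
open import Data.List.Membership.Propositional.Properties using (∈-map⁺; ∈-++⁺ˡ; ∈-++⁺ʳ)
open import Data.List.Relation.Binary.Subset.Propositional using (_⊆_)
open import Data.List.Relation.Unary.All as All using (All; []; _∷_)
open import Data.List.Relation.Unary.All.Properties using (¬Any⇒All¬)
open import Data.List.Relation.Unary.Any using (Any; here; there; any?; _─_)
open import Data.List.Relation.Unary.AllPairs using ([]; _∷_)
open import Data.List.Relation.Unary.Unique.Propositional using (Unique)
open import Data.Nat using (ℕ; zero; suc; _+_; _*_; _^_; _∸_; _≤_; _<_; z≤n; s≤s; _≤?_; _<?_)
open import Data.Nat.Properties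
  using (_≟_; ≤-refl; ≤-reflexive; ≤-trans; ≤-antisym; <-trans; <-≤-trans; <-irrefl; <-cmp; <⇒≤; <⇒≱;
         ≮⇒≥; >⇒≢; ≤∧≢⇒<; ≤-pred; n≤1+n; n<1+n; m≤m+n; m<m+n; m≤n⇒m<n∨m≡n; +-comm; +-suc;
         +-identityʳ; +-monoˡ-≤; +-monoʳ-≤; +-monoˡ-<; +-monoʳ-<; +-cancelˡ-≤; +-cancelʳ-≤; m+[n∸m]≡n;
         m+n≤o⇒m≤o∸n; *-monoʳ-≤; m^n>0; module ≤-Reasoning)
open import Data.Product as Product using (Σ; ∃; _×_; _,_; proj₁; proj₂)
open import Data.Sum using (_⊎_; inj₁; inj₂; [_,_]′; map₁; swap)
open import Data.Vec using (Vec; []; _∷_; lookup; tabulate; replicate; _[_]%=_; zipWith)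
open import Data.Vec.Properties as Vec
  using (updateAt-updateAt-local; updateAt-id; lookup∘updateAt; lookup∘updateAt′; lookup∘tabulate;
         tabulate∘lookup; tabulate-cong; lookup-zipWith; lookup-replicate)
open import Function using (_∘_)
open import Relation.Binary.Definitions using (Symmetric; DecidableEquality; tri<; tri≈; tri>)
open import Relation.Binary.PropositionalEquality
  using (_≡_; _≢_; refl; sym; trans; cong; cong₂; subst; subst₂; module ≡-Reasoning)
open import Relation.Nullary using (¬_; Dec; yes; no; contradiction)
open import Relation.Nullary.Decidable using (_×-dec_)

open import Defs

+-squeeze : ∀ {a b c e} → a + b ≤ c + e → c ≤ a → e ≤ b → a ≡ c
+-squeeze {a} {b} {c} {e} a+b≤c+e c≤a e≤b =
  ≤-antisym (+-cancelʳ-≤ b a c (≤-trans a+b≤c+e (+-monoʳ-≤ c e≤b))) c≤a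

lookup-ext : ∀ {A : Set} {n} {a b : Vec A n} → (∀ i → lookup a i ≡ lookup b i) → a ≡ b
lookup-ext {a = a} {b} a≗b = trans (sym (tabulate∘lookup a)) (trans (tabulate-cong a≗b) (tabulate∘lookup b))

module _ {A : Set} where

  ∈-─ : ∀ {x y} {ys : List A} (p : x ∈ ys) → y ∈ ys → y ≢ x → y ∈ (ys ─ p)
  ∈-─ (here refl) (here refl) y≢x = contradiction refl y≢x
  ∈-─ (here refl) (there q)   y≢x = q
  ∈-─ (there p)   (here refl) y≢x = here refl
  ∈-─ (there p)   (there q)   y≢x = there (∈-─ p q y≢x)

  length-─ : ∀ {x} {ys : List A} (p : x ∈ ys) → suc (length (ys ─ p)) ≡ length ys
  length-─ (here refl) = refl
  length-─ (there p)   = cong suc (length-─ p)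

  Unique-⊆⇒length≤ : ∀ {xs ys : List A} → Unique xs → xs ⊆ ys → length xs ≤ length ys
  Unique-⊆⇒length≤ {[]}          _           _     = z≤n
  Unique-⊆⇒length≤ {x ∷ xs} {ys} (x∉ ∷ uniq) xs⊆ys = begin
    suc (length xs)         ≤⟨ s≤s (Unique-⊆⇒length≤ uniq xs⊆ys─x) ⟩
    suc (length (ys ─ x∈))  ≡⟨ length-─ x∈ ⟩
    length ys               ∎
    where
    open ≤-Reasoning
    x∈ = xs⊆ys (here refl)
    xs⊆ys─x : xs ⊆ (ys ─ x∈)
    xs⊆ys─x y∈ = ∈-─ x∈ (xs⊆ys (there y∈)) (λ y≡x → All.lookup x∉ y∈ (sym y≡x))

module _ {A B : Set} {R : A → B → Set} where

  injective-labelling⇒length≤ : ∀ {xs : List A} {zs ys : List B} → Unique xs → Unique zs →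
    (∀ b → b ∈ ys) → (∀ {x} → x ∈ xs → ∃ (R x)) →
    (∀ {x y b} → x ∈ xs → y ∈ xs → R x b → R y b → x ≡ y) →
    (∀ {x b} → x ∈ xs → R x b → b ∉ zs) →
    length xs + length zs ≤ length ys
  injective-labelling⇒length≤ {[]} _ uniqᶻ complete _ _ _ = Unique-⊆⇒length≤ uniqᶻ (λ {b} _ → complete b)
  injective-labelling⇒length≤ {x ∷ xs} {zs} {ys} (x∉ ∷ uniq) uniqᶻ complete label injective unused =
    subst (_≤ length ys) (+-suc (length xs) (length zs))
      (injective-labelling⇒length≤ uniq (¬Any⇒All¬ zs (unused (here refl) r) ∷ uniqᶻ) complete
        (label ∘ there) (λ p q → injective (there p) (there q)) unused′)
    where
    b = proj₁ (label (here refl))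
    r = proj₂ (label (here refl))
    unused′ : ∀ {y c} → y ∈ xs → R y c → c ∉ b ∷ zs
    unused′ y∈ s (here refl) = All.lookup x∉ y∈ (sym (injective (there y∈) (here refl) s r))
    unused′ y∈ s (there c∈)  = unused (there y∈) s c∈

allVecs : ∀ n → List (Vec Bool n)
allVecs zero    = [] ∷ []
allVecs (suc n) = map (true ∷_) (allVecs n) ++ map (false ∷_) (allVecs n)

∈-allVecs : ∀ {n} (c : Vec Bool n) → c ∈ allVecs n
∈-allVecs []                  = here refl
∈-allVecs (true  ∷ c)         = ∈-++⁺ˡ (∈-map⁺ (true ∷_) (∈-allVecs c))
∈-allVecs {suc n} (false ∷ c) = ∈-++⁺ʳ (map (true ∷_) (allVecs n)) (∈-map⁺ (false ∷_) (∈-allVecs c))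

length-allVecs : ∀ n → length (allVecs n) ≡ 2 ^ n
length-allVecs zero    = refl
length-allVecs (suc n) = begin
  length (map (true ∷_) (allVecs n) ++ map (false ∷_) (allVecs n))
    ≡⟨ length-++ (map (true ∷_) (allVecs n)) ⟩
  length (map (true ∷_) (allVecs n)) + length (map (false ∷_) (allVecs n))
    ≡⟨ cong₂ _+_ (length-map _ (allVecs n)) (length-map _ (allVecs n)) ⟩
  length (allVecs n) + length (allVecs n)
    ≡⟨ cong (λ m → m + m) (length-allVecs n) ⟩
  2 ^ n + 2 ^ n
    ≡⟨ cong (2 ^ n +_) (sym (+-identityʳ (2 ^ n))) ⟩
  2 ^ suc n ∎
  where open ≡-Reasoning

module Walks {V : Set} (Adj : V → V → Set) (Adj-sym : Symmetric Adj) where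

  ∣_∣ : ∀ {x y} → Walk Adj x y → ℕ
  ∣_∣ = len Adj

  vertices : ∀ {x y} → Walk Adj x y → List V
  vertices {x} nil        = x ∷ []
  vertices {x} (cons _ w) = x ∷ vertices w

  source∈ : ∀ {x y} (w : Walk Adj x y) → x ∈ vertices w
  source∈ nil        = here refl
  source∈ (cons _ w) = here refl

  infixr 5 _++ʷ_
  _++ʷ_ : ∀ {x y z} → Walk Adj x y → Walk Adj y z → Walk Adj x z
  nil      ++ʷ w′ = w′
  cons e w ++ʷ w′ = cons e (w ++ʷ w′)

  len-++ʷ : ∀ {x y z} (w : Walk Adj x y) (w′ : Walk Adj y z) → ∣ w ++ʷ w′ ∣ ≡ ∣ w ∣ + ∣ w′ ∣
  len-++ʷ nil        w′ = refl
  len-++ʷ (cons e w) w′ = cong suc (len-++ʷ w w′)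

  ∈-++ʷ⁻ : ∀ {x y z v} (w : Walk Adj x y) (w′ : Walk Adj y z) →
    v ∈ vertices (w ++ʷ w′) → v ∈ vertices w ⊎ v ∈ vertices w′
  ∈-++ʷ⁻ nil        w′ v∈          = inj₂ v∈
  ∈-++ʷ⁻ (cons e w) w′ (here refl) = inj₁ (here refl)
  ∈-++ʷ⁻ (cons e w) w′ (there v∈)  = map₁ there (∈-++ʷ⁻ w w′ v∈)

  reverse : ∀ {x y} → Walk Adj x y → Walk Adj y x
  reverse nil        = nil
  reverse (cons e w) = reverse w ++ʷ cons (Adj-sym e) nil

  len-reverse : ∀ {x y} (w : Walk Adj x y) → ∣ reverse w ∣ ≡ ∣ w ∣
  len-reverse nil        = refl
  len-reverse (cons e w) =
    trans (len-++ʷ (reverse w) _) (trans (+-comm ∣ reverse w ∣ 1) (cong suc (len-reverse w)))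

  ∈-reverse⁻ : ∀ {x y v} (w : Walk Adj x y) → v ∈ vertices (reverse w) → v ∈ vertices w
  ∈-reverse⁻ nil        v∈ = v∈
  ∈-reverse⁻ (cons e w) v∈ with ∈-++ʷ⁻ (reverse w) _ v∈
  ... | inj₁ v∈′                 = there (∈-reverse⁻ w v∈′)
  ... | inj₂ (here refl)         = there (source∈ w)
  ... | inj₂ (there (here refl)) = here refl

  prefix : ∀ {x y z} (w : Walk Adj x y) → z ∈ vertices w → Walk Adj x z
  prefix nil        (here refl) = nil
  prefix (cons e w) (here refl) = nil
  prefix (cons e w) (there z∈)  = cons e (prefix w z∈)

  suffix : ∀ {x y z} (w : Walk Adj x y) → z ∈ vertices w → Walk Adj z y
  suffix nil        (here refl) = nil
  suffix (cons e w) (here refl) = cons e w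
  suffix (cons e w) (there z∈)  = suffix w z∈

  len-prefix+suffix : ∀ {x y z} (w : Walk Adj x y) (z∈ : z ∈ vertices w) →
    ∣ prefix w z∈ ∣ + ∣ suffix w z∈ ∣ ≡ ∣ w ∣
  len-prefix+suffix nil        (here refl) = refl
  len-prefix+suffix (cons e w) (here refl) = refl
  len-prefix+suffix (cons e w) (there z∈)  = cong suc (len-prefix+suffix w z∈)

  prefix-⊆ : ∀ {x y z} (w : Walk Adj x y) (z∈ : z ∈ vertices w) → vertices (prefix w z∈) ⊆ vertices w
  prefix-⊆ nil        (here refl) (here refl) = here refl
  prefix-⊆ (cons e w) (here refl) (here refl) = here refl
  prefix-⊆ (cons e w) (there z∈)  (here refl) = here refl
  prefix-⊆ (cons e w) (there z∈)  (there v∈)  = there (prefix-⊆ w z∈ v∈)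

  shortest-prefix-len : ∀ {x y z t} {w : Walk Adj x y} → IsShortest Adj w → (z∈ : z ∈ vertices w) →
    (a : Walk Adj x t) (b : Walk Adj t y) → ∣ a ∣ ≤ ∣ prefix w z∈ ∣ → ∣ b ∣ ≤ ∣ suffix w z∈ ∣ →
    ∣ prefix w z∈ ∣ ≡ ∣ a ∣
  shortest-prefix-len {w = w} shortest z∈ a b a≤ b≤ = +-squeeze (begin
    ∣ prefix w z∈ ∣ + ∣ suffix w z∈ ∣ ≡⟨ len-prefix+suffix w z∈ ⟩
    ∣ w ∣                             ≤⟨ shortest (a ++ʷ b) ⟩
    ∣ a ++ʷ b ∣                       ≡⟨ len-++ʷ a b ⟩
    ∣ a ∣ + ∣ b ∣                     ∎) a≤ b≤
    where open ≤-Reasoning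

  ∈-vertices⇒endpoint⊎interior : ∀ {x y v} (w : Walk Adj x y) → v ∈ vertices w →
    v ≡ x ⊎ v ∈ interior Adj w ⊎ v ≡ y
  ∈-vertices⇒endpoint⊎interior nil                  (here refl)         = inj₁ refl
  ∈-vertices⇒endpoint⊎interior (cons e w)           (here refl)         = inj₁ refl
  ∈-vertices⇒endpoint⊎interior (cons e nil)         (there (here refl)) = inj₂ (inj₂ refl)
  ∈-vertices⇒endpoint⊎interior (cons e (cons e′ w)) (there v∈)
    with ∈-vertices⇒endpoint⊎interior (cons e′ w) v∈
  ... | inj₁ refl        = inj₂ (inj₁ (here refl))
  ... | inj₂ (inj₁ v∈′)  = inj₂ (inj₁ (there v∈′))
  ... | inj₂ (inj₂ refl) = inj₂ (inj₂ refl)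

  visible-path-endpoint : ∀ {X : List V} {x y v} (w : Walk Adj x y) →
    All (λ u → ¬ u ∈ X) (interior Adj w) → v ∈ X → v ∈ vertices w → v ≡ x ⊎ v ≡ y
  visible-path-endpoint w clear v∈X v∈w with ∈-vertices⇒endpoint⊎interior w v∈w
  ... | inj₁ v≡x          = inj₁ v≡x
  ... | inj₂ (inj₁ v∈int) = contradiction v∈X (All.lookup clear v∈int)
  ... | inj₂ (inj₂ v≡y)   = inj₂ v≡y

module Butterfly (d : ℕ) where

  V : Set
  V = BFVertex d

  level : V → ℕ
  level u = toℕ (proj₁ u)

  column : V → Vec Bool d
  column = proj₂

  bit : V → Fin d → Bool
  bit u = lookup (column u)

  BFAdj-sym : Symmetric (BFAdj d)
  BFAdj-sym = swap

  open Walks (BFAdj d) BFAdj-sym public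

  BFWalk : V → V → Set
  BFWalk = Walk (BFAdj d)

  _≟ᶜ_ : DecidableEquality (Vec Bool d)
  _≟ᶜ_ = Vec.≡-dec Bool._≟_

  vertex-≡ : ∀ {u v} → level u ≡ level v → column u ≡ column v → u ≡ v
  vertex-≡ {ℓ , c} ℓ≡ℓ′ refl with toℕ-injective ℓ≡ℓ′
  ... | refl = refl

  level≤d : ∀ u → level u ≤ d
  level≤d u = ≤-pred (toℕ<n (proj₁ u))

  level-down : ∀ {u v} → BFDown d u v → level v ≡ suc (level u)
  level-down (straight l c) = cong suc (sym (toℕ-inject₁ l))
  level-down (cross    l c) = cong suc (sym (toℕ-inject₁ l))

  level-down-< : ∀ {u v} → BFDown d u v → level u < level v
  level-down-< e = ≤-reflexive (sym (level-down e))

  bit-down : ∀ {u v i} → BFDown d u v → toℕ i ≢ level u → bit v i ≡ bit u i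
  bit-down         (straight l c) i≢l = refl
  bit-down {i = i} (cross    l c) i≢l =
    lookup∘updateAt′ i l (λ i≡l → i≢l (trans (cong toℕ i≡l) (sym (toℕ-inject₁ l)))) c

  level-adj-≤ : ∀ {u v} → BFAdj d u v → level v ≤ suc (level u)
  level-adj-≤         (inj₁ e) = ≤-reflexive (level-down e)
  level-adj-≤ {u} {v} (inj₂ e) =
    ≤-trans (n≤1+n (level v)) (≤-trans (≤-reflexive (sym (level-down e))) (n≤1+n (level u)))

  level-target-≤ : ∀ {u v} (w : BFWalk u v) → level v ≤ level u + ∣ w ∣
  level-target-≤ {u}     nil                 = m≤m+n (level u) 0
  level-target-≤ {u} {v} (cons {y = u₁} e w) = begin
    level v                ≤⟨ level-target-≤ w ⟩
    level u₁ + ∣ w ∣       ≤⟨ +-monoˡ-≤ ∣ w ∣ (level-adj-≤ e) ⟩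
    suc (level u) + ∣ w ∣  ≡⟨ sym (+-suc (level u) ∣ w ∣) ⟩
    level u + suc ∣ w ∣    ∎
    where open ≤-Reasoning

  Ascending : ∀ {u v} → BFWalk u v → Set
  Ascending {u} {v} w = level u + ∣ w ∣ ≡ level v

  AgreeOutside : V → V → Set
  AgreeOutside u v = ∀ i → toℕ i < level u ⊎ level v ≤ toℕ i → bit u i ≡ bit v i

  ascending-len-≤ : ∀ {p q a b} {s : BFWalk p q} → Ascending s → (w : BFWalk a b) →
    level a ≤ level p → level q ≤ level b → ∣ s ∣ ≤ ∣ w ∣
  ascending-len-≤ {p} {q} {a} {b} {s} asc w a≤p q≤b = +-cancelˡ-≤ (level a) ∣ s ∣ ∣ w ∣ (begin
    level a + ∣ s ∣  ≤⟨ +-monoˡ-≤ ∣ s ∣ a≤p ⟩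
    level p + ∣ s ∣  ≡⟨ asc ⟩
    level q          ≤⟨ q≤b ⟩
    level b          ≤⟨ level-target-≤ w ⟩
    level a + ∣ w ∣  ∎)
    where open ≤-Reasoning

  ascending-cons : ∀ {u u₁ v} (e : BFDown d u u₁) {w : BFWalk u₁ v} → Ascending w →
    Ascending (cons (inj₁ e) w)
  ascending-cons {u} e {w} asc =
    trans (+-suc (level u) ∣ w ∣) (trans (cong (_+ ∣ w ∣) (sym (level-down e))) asc)

  ascending-uncons : ∀ {u u₁ v} (e : BFAdj d u u₁) (w : BFWalk u₁ v) → Ascending (cons e w) →
    BFDown d u u₁ × Ascending w
  ascending-uncons {u} {u₁} {v} (inj₁ e) w asc = e , (begin
    level u₁ + ∣ w ∣       ≡⟨ cong (_+ ∣ w ∣) (level-down e) ⟩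
    suc (level u) + ∣ w ∣  ≡⟨ sym (+-suc (level u) ∣ w ∣) ⟩
    level u + suc ∣ w ∣    ≡⟨ asc ⟩
    level v                ∎)
    where open ≡-Reasoning
  ascending-uncons {u} {u₁} {v} (inj₂ e) w asc = contradiction (level-target-≤ w) (<⇒≱ (begin-strict
    level u₁ + ∣ w ∣      <⟨ +-monoʳ-< (level u₁) (n<1+n ∣ w ∣) ⟩
    level u₁ + suc ∣ w ∣  <⟨ +-monoˡ-< (suc ∣ w ∣) (level-down-< e) ⟩
    level u + suc ∣ w ∣   ≡⟨ asc ⟩
    level v               ∎))
    where open ≤-Reasoning

  ascending⇒agreeOutside : ∀ {u v} {w : BFWalk u v} → Ascending w → AgreeOutside u v
  ascending⇒agreeOutside {w = nil} asc i _ = refl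
  ascending⇒agreeOutside {u} {v} {cons {y = u₁} e w} asc i outside with ascending-uncons e w asc
  ... | down , asc′ = trans (sym (bit-down down i≢u))
                        (ascending⇒agreeOutside asc′ i (map₁ (λ i<u → <-trans i<u (level-down-< down)) outside))
    where
    i≢u : toℕ i ≢ level u
    i≢u i≡u = [ <-irrefl i≡u , (λ v≤i → <⇒≱ (level-down-< down) (begin
      level u₁          ≤⟨ m≤m+n (level u₁) ∣ w ∣ ⟩
      level u₁ + ∣ w ∣  ≡⟨ asc′ ⟩
      level v           ≤⟨ v≤i ⟩
      toℕ i             ≡⟨ i≡u ⟩
      level u           ∎)) ]′ outside
      where open ≤-Reasoning

  ascending-∋ : ∀ {u v r} {w : BFWalk u v} → Ascending w → level u ≤ level r → level r ≤ level v →
    (∀ i → toℕ i < level r → bit r i ≡ bit v i) → (∀ i → level r ≤ toℕ i → bit r i ≡ bit u i) →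
    r ∈ vertices w
  ascending-∋ {u} {v} {r} {w} asc u≤r r≤v below above with m≤n⇒m<n∨m≡n u≤r
  ... | inj₂ u≡r = subst (_∈ vertices w) (vertex-≡ u≡r (lookup-ext u≗r)) (source∈ w)
    where
    u≗r : ∀ i → bit u i ≡ bit r i
    u≗r i with toℕ i <? level r
    ... | yes i<r = trans (ascending⇒agreeOutside asc i (inj₁ (subst (toℕ i <_) (sym u≡r) i<r))) (sym (below i i<r))
    ... | no  i≮r = sym (above i (≮⇒≥ i≮r))
  ascending-∋ {w = nil} asc u≤r r≤v below above | inj₁ u<r = contradiction r≤v (<⇒≱ u<r)
  ascending-∋ {u} {r = r} {cons {y = u₁} e w} asc u≤r r≤v below above | inj₁ u<r with ascending-uncons e w asc
  ... | down , asc′ = there (ascending-∋ asc′ (subst (_≤ level r) (sym (level-down down)) u<r) r≤v below above′)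
    where
    above′ : ∀ i → level r ≤ toℕ i → bit r i ≡ bit u₁ i
    above′ i r≤i =
      trans (above i r≤i) (sym (bit-down down (λ i≡u → <⇒≱ u<r (≤-trans r≤i (≤-reflexive i≡u)))))

  private
    inject₁-onto : ∀ {n} (i : Fin (suc n)) → toℕ i < n → ∃ λ l → inject₁ l ≡ i
    inject₁-onto i i<n = lower₁ i (>⇒≢ i<n) , inject₁-lower₁ i (>⇒≢ i<n)

    stepTowards : (l : Fin d) (c t : Vec Bool d) → ∃ λ c′ → BFDown d (inject₁ l , c) (fsuc l , c′) ×
      lookup c′ l ≡ lookup t l × (∀ i → i ≢ l → lookup c′ i ≡ lookup c i)
    stepTowards l c t with lookup c l Bool.≟ lookup t l
    ... | yes same  = c , straight l c , same , λ _ _ → refl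
    ... | no differ = c [ l ]%= not , cross l c ,
                      trans (lookup∘updateAt l c) (sym (Bool.¬-not (differ ∘ sym))) ,
                      λ i i≢l → lookup∘updateAt′ i l i≢l c

    ascendingWalkOfLength : ∀ n {u v} → level u + n ≡ level v → AgreeOutside u v → Σ (BFWalk u v) Ascending
    ascendingWalkOfLength zero {u} {v} u+0≡v agree =
      subst (λ x → Σ (BFWalk u x) Ascending) (vertex-≡ u≡v (lookup-ext u≗v)) (nil , +-identityʳ (level u))
      where
      u≡v : level u ≡ level v
      u≡v = trans (sym (+-identityʳ (level u))) u+0≡v
      u≗v : ∀ i → bit u i ≡ bit v i
      u≗v i with toℕ i <? level u
      ... | yes i<u = agree i (inj₁ i<u)
      ... | no  i≮u = agree i (inj₂ (subst (_≤ toℕ i) u≡v (≮⇒≥ i≮u)))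
    ascendingWalkOfLength (suc n) {ℓ , c} {v} ℓ+n≡v agree
      with inject₁-onto ℓ (<-≤-trans (m<m+n (toℕ ℓ) (s≤s z≤n)) (≤-trans (≤-reflexive ℓ+n≡v) (level≤d v)))
    ... | l , refl with stepTowards l c (column v)
    ... | c′ , edge , fixed , others with ascendingWalkOfLength n {fsuc l , c′} {v} ℓ′+n≡v agree′
      where
      ℓ′+n≡v : suc (toℕ l) + n ≡ level v
      ℓ′+n≡v = trans (cong (_+ n) (level-down edge)) (trans (sym (+-suc (toℕ (inject₁ l)) n)) ℓ+n≡v)
      agree′ : AgreeOutside (fsuc l , c′) v
      agree′ i outside with i Fin.≟ l
      ... | yes refl = fixed
      ... | no  i≢l  = trans (others i i≢l) (agree i (map₁ i<l outside))
        where
        i<l : toℕ i < suc (toℕ l) → toℕ i < toℕ (inject₁ l)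
        i<l i<sl = subst (toℕ i <_) (sym (toℕ-inject₁ l)) (≤∧≢⇒< (≤-pred i<sl) (i≢l ∘ toℕ-injective))
    ... | w , asc = cons (inj₁ edge) w , ascending-cons edge asc

  ascendingWalk : ∀ {u v} → level u ≤ level v → AgreeOutside u v → Σ (BFWalk u v) Ascending
  ascendingWalk u≤v = ascendingWalkOfLength _ (m+[n∸m]≡n u≤v)

  shortest⇒ascending : ∀ {u v} {w : BFWalk u v} → level u ≤ level v → AgreeOutside u v →
    IsShortest (BFAdj d) w → Ascending w
  shortest⇒ascending {u} {v} {w} u≤v agree shortest = ≤-antisym (begin
    level u + ∣ w ∣        ≤⟨ +-monoʳ-≤ (level u) (shortest (proj₁ s)) ⟩
    level u + ∣ proj₁ s ∣  ≡⟨ proj₂ s ⟩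
    level v                ∎) (level-target-≤ w)
    where
    open ≤-Reasoning
    s = ascendingWalk u≤v agree

  edge-crossing : ∀ {u u₁} k → BFAdj d u u₁ → bit u k ≢ bit u₁ k →
    (level u ≡ toℕ k × level u₁ ≡ suc (toℕ k)) ⊎ (level u₁ ≡ toℕ k × level u ≡ suc (toℕ k))
  edge-crossing {u} k (inj₁ e) changed with toℕ k ≟ level u
  ... | yes k≡u = inj₁ (sym k≡u , trans (level-down e) (cong suc (sym k≡u)))
  ... | no  k≢u = contradiction (sym (bit-down e k≢u)) changed
  edge-crossing {u₁ = u₁} k (inj₂ e) changed with toℕ k ≟ level u₁
  ... | yes k≡u₁ = inj₂ (sym k≡u₁ , trans (level-down e) (cong suc (sym k≡u₁)))
  ... | no  k≢u₁ = contradiction (bit-down e k≢u₁) changed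

  bit-change⇒crossing : ∀ {u v} k (w : BFWalk u v) → bit u k ≢ bit v k →
    Any (λ z → level z ≡ toℕ k) (vertices w) × Any (λ z → level z ≡ suc (toℕ k)) (vertices w)
  bit-change⇒crossing k nil changed = contradiction refl changed
  bit-change⇒crossing {u} k (cons {y = u₁} e w) changed with bit u k Bool.≟ bit u₁ k
  ... | yes same = Product.map there there (bit-change⇒crossing k w (changed ∘ trans same))
  ... | no  differs with edge-crossing k e differs
  ...   | inj₁ (u≡k , u₁≡k+1) = here u≡k , there (lose (source∈ w) u₁≡k+1)
  ...   | inj₂ (u₁≡k , u≡k+1) = there (lose (source∈ w) u₁≡k) , here u≡k+1

  private
    keyBit : Vec Bool d → V → Fin d → Bool
    keyBit F u i with toℕ i <? level u
    ... | yes _ = lookup F i xor bit u i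
    ... | no  _ = bit u i

    xor-cancelˡ : ∀ a {x y} → a xor x ≡ a xor y → x ≡ y
    xor-cancelˡ false eq = eq
    xor-cancelˡ true  eq = Bool.not-injective eq

  key : Vec Bool d → V → Vec Bool d
  key F u = tabulate (keyBit F u)

  key-below : ∀ F u {i} → toℕ i < level u → lookup (key F u) i ≡ lookup F i xor bit u i
  key-below F u {i} i<u rewrite lookup∘tabulate (keyBit F u) i with toℕ i <? level u
  ... | yes _   = refl
  ... | no  i≮u = contradiction i<u i≮u

  key-above : ∀ F u {i} → level u ≤ toℕ i → lookup (key F u) i ≡ bit u i
  key-above F u {i} u≤i rewrite lookup∘tabulate (keyBit F u) i with toℕ i <? level u
  ... | yes i<u = contradiction u≤i (<⇒≱ i<u)
  ... | no  _   = refl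

  key-flat : ∀ F u {i} → lookup F i ≡ false → lookup (key F u) i ≡ bit u i
  key-flat F u {i} Fᵢ≡false with toℕ i <? level u
  ... | yes i<u = trans (key-below F u i<u) (cong (_xor bit u i) Fᵢ≡false)
  ... | no  i≮u = key-above F u (≮⇒≥ i≮u)

  module _ {F : Vec Bool d} {p q : V} (p~q : key F p ≡ key F q) where

    private
      key-bit : ∀ i → lookup (key F p) i ≡ lookup (key F q) i
      key-bit i = cong (λ s → lookup s i) p~q

    sameLine-below : ∀ {i} → toℕ i < level p → toℕ i < level q → bit p i ≡ bit q i
    sameLine-below {i} i<p i<q =
      xor-cancelˡ (lookup F i) (trans (sym (key-below F p i<p)) (trans (key-bit i) (key-below F q i<q)))

    sameLine-above : ∀ {i} → level p ≤ toℕ i → level q ≤ toℕ i → bit p i ≡ bit q i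
    sameLine-above {i} p≤i q≤i = trans (sym (key-above F p p≤i)) (trans (key-bit i) (key-above F q q≤i))

    sameLine-flat : ∀ {i} → lookup F i ≡ false → bit p i ≡ bit q i
    sameLine-flat {i} Fᵢ≡false = trans (sym (key-flat F p Fᵢ≡false)) (trans (key-bit i) (key-flat F q Fᵢ≡false))

    sameLine-level : level p ≡ level q → p ≡ q
    sameLine-level p≡q = vertex-≡ p≡q (lookup-ext p≗q)
      where
      p≗q : ∀ i → bit p i ≡ bit q i
      p≗q i with toℕ i <? level p
      ... | yes i<p = sameLine-below i<p (subst (toℕ i <_) p≡q i<p)
      ... | no  i≮p = sameLine-above (≮⇒≥ i≮p) (subst (_≤ toℕ i) p≡q (≮⇒≥ i≮p))

    sameLine⇒agreeOutside : level p ≤ level q → AgreeOutside p q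
    sameLine⇒agreeOutside p≤q i (inj₁ i<p) = sameLine-below i<p (<-≤-trans i<p p≤q)
    sameLine⇒agreeOutside p≤q i (inj₂ q≤i) = sameLine-above (≤-trans p≤q q≤i) q≤i

    sameLine-column-above : level q ≤ level p → (∀ i → level q ≤ toℕ i → lookup F i ≡ false) →
      column p ≡ column q
    sameLine-column-above q≤p flat = lookup-ext p≗q
      where
      p≗q : ∀ i → bit p i ≡ bit q i
      p≗q i with toℕ i <? level q
      ... | yes i<q = sameLine-below (<-≤-trans i<q q≤p) i<q
      ... | no  i≮q = sameLine-flat (flat i (≮⇒≥ i≮q))

    sameLine-column-below : level p ≤ level q → (∀ i → toℕ i < level q → lookup F i ≡ false) →
      column p ≡ column q
    sameLine-column-below p≤q flat = lookup-ext p≗q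
      where
      p≗q : ∀ i → bit p i ≡ bit q i
      p≗q i with toℕ i <? level q
      ... | yes i<q = sameLine-flat (flat i i<q)
      ... | no  i≮q = sameLine-above (≤-trans p≤q (≮⇒≥ i≮q)) (≮⇒≥ i≮q)

  sameLine-∈-ascending : ∀ {F p q r} {w : BFWalk p q} → Ascending w → key F p ≡ key F r →
    key F r ≡ key F q → level p ≤ level r → level r ≤ level q → r ∈ vertices w
  sameLine-∈-ascending asc p~r r~q p≤r r≤q = ascending-∋ asc p≤r r≤q
    (λ i i<r → sameLine-below r~q i<r (<-≤-trans i<r r≤q))
    (λ i r≤i → sameLine-above (sym p~r) r≤i (≤-trans p≤r r≤i))

  F₀ : Vec Bool d
  F₀ = replicate d false

  key-F₀ : ∀ x → key F₀ x ≡ column x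
  key-F₀ x = lookup-ext (λ i → key-flat F₀ x (lookup-replicate i false))

  column⇒sameLine : ∀ x y → column x ≡ column y → key F₀ x ≡ key F₀ y
  column⇒sameLine x y x≡y = trans (key-F₀ x) (trans x≡y (sym (key-F₀ y)))

  slope : V → V → Vec Bool d
  slope p q = zipWith _xor_ (column p) (column q)

  slope-flat : ∀ {p q i} → bit p i ≡ bit q i → lookup (slope p q) i ≡ false
  slope-flat {p} {q} {i} pᵢ≡qᵢ = trans (lookup-zipWith _xor_ i (column p) (column q))
    (trans (cong (_xor bit q i) pᵢ≡qᵢ) (xor-same (bit q i)))

  key-slope : ∀ {p q} → level p ≤ level q → AgreeOutside p q → key (slope p q) p ≡ key (slope p q) q
  key-slope {p} {q} p≤q agree = lookup-ext p≗q
    where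
    F = slope p q
    outside-≡ : ∀ i → toℕ i < level p ⊎ level q ≤ toℕ i → lookup (key F p) i ≡ lookup (key F q) i
    outside-≡ i outside = trans (key-flat F p Fᵢ≡false) (trans (agree i outside) (sym (key-flat F q Fᵢ≡false)))
      where Fᵢ≡false = slope-flat {p} {q} (agree i outside)
    p≗q : ∀ i → lookup (key F p) i ≡ lookup (key F q) i
    p≗q i with toℕ i <? level p | toℕ i <? level q
    ... | yes i<p | _       = outside-≡ i (inj₁ i<p)
    ... | no  _   | no  i≮q = outside-≡ i (inj₂ (≮⇒≥ i≮q))
    ... | no  i≮p | yes i<q = begin
      lookup (key F p) i                 ≡⟨ key-above F p (≮⇒≥ i≮p) ⟩
      bit p i                            ≡⟨ sym (xor-identityʳ (bit p i)) ⟩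
      bit p i xor false                  ≡⟨ cong (bit p i xor_) (sym (xor-same (bit q i))) ⟩
      bit p i xor (bit q i xor bit q i)  ≡⟨ sym (xor-assoc (bit p i) (bit q i) (bit q i)) ⟩
      (bit p i xor bit q i) xor bit q i  ≡⟨ cong (_xor bit q i) (sym (lookup-zipWith _ i (column p) (column q))) ⟩
      lookup F i xor bit q i             ≡⟨ sym (key-below F q i<q) ⟩
      lookup (key F q) i                 ∎
      where open ≡-Reasoning

  flipBit : Fin d → Vec Bool d → Vec Bool d
  flipBit k c = c [ k ]%= not

  flipBit-injective : ∀ k {c c′} → flipBit k c ≡ flipBit k c′ → c ≡ c′
  flipBit-injective k {c} {c′} eq = trans (sym (involutive c)) (trans (cong (flipBit k) eq) (involutive c′))
    where
    involutive : ∀ c → flipBit k (flipBit k c) ≡ c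
    involutive c = trans (updateAt-updateAt-local k {h = λ b → b} c (not-involutive _)) (updateAt-id k c)

  flipBit-changes : ∀ {u v} k → column v ≡ flipBit k (column u) → bit u k ≢ bit v k
  flipBit-changes {u} k v≡ uₖ≡vₖ =
    Bool.not-¬ refl (trans uₖ≡vₖ (trans (cong (λ c → lookup c k) v≡) (lookup∘updateAt k (column u))))

  flipBit-keeps : ∀ {u v} {i} k → column v ≡ flipBit k (column u) → i ≢ k → bit u i ≡ bit v i
  flipBit-keeps {u} {i = i} k v≡ i≢k =
    sym (trans (cong (λ c → lookup c i) v≡) (lookup∘updateAt′ i k i≢k (column u)))

module Visibility (d : ℕ) {X : List (BFVertex d)} (mv : MutualVisibility (BFAdj d) X) where

  open Butterfly d

  sameLine-on-visible-path : ∀ {F u v p q y} {w : BFWalk u v} {s : BFWalk p q} →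
    All (λ z → ¬ z ∈ X) (interior (BFAdj d) w) → vertices s ⊆ vertices w → Ascending s →
    key F p ≡ key F y → key F y ≡ key F q → level p ≤ level y → level y ≤ level q → y ∈ X →
    y ≡ u ⊎ y ≡ v
  sameLine-on-visible-path {w = w} clear s⊆w asc p~y y~q p≤y y≤q y∈X =
    visible-path-endpoint w clear y∈X (s⊆w (sameLine-∈-ascending asc p~y y~q p≤y y≤q))

  no-three-on-line : ∀ {F p r q} → p ∈ X → r ∈ X → q ∈ X → key F p ≡ key F r → key F r ≡ key F q →
    level p < level r → level r < level q → ⊥
  no-three-on-line p∈ r∈ q∈ p~r r~q p<r r<q with mv p∈ q∈
  ... | w , shortest , clear
    with sameLine-on-visible-path clear (λ z∈ → z∈) asc p~r r~q (<⇒≤ p<r) (<⇒≤ r<q) r∈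
    where
    p≤q = <⇒≤ (<-trans p<r r<q)
    asc = shortest⇒ascending p≤q (sameLine⇒agreeOutside (trans p~r r~q) p≤q) shortest
  ... | inj₁ refl = <-irrefl refl p<r
  ... | inj₂ refl = <-irrefl refl r<q

  TwoPoints : Vec Bool d → Vec Bool d → Set
  TwoPoints F s = Any (λ x → key F x ≡ s × Any (λ y → key F y ≡ s × level x < level y) X) X

  twoPoints? : ∀ F s → Dec (TwoPoints F s)
  twoPoints? F s =
    any? (λ x → (key F x ≟ᶜ s) ×-dec any? (λ y → (key F y ≟ᶜ s) ×-dec (level x <? level y)) X) X

  twoPoints : ∀ {F s x y} → x ∈ X → y ∈ X → key F x ≡ s → key F y ≡ s → level x < level y →
    TwoPoints F s
  twoPoints x∈ y∈ x~s y~s x<y = lose x∈ (x~s , lose y∈ (y~s , x<y))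

  Deficient : Vec Bool d → Vec Bool d → Set
  Deficient F s = ¬ TwoPoints F s

  deficient-≡ : ∀ {F s x y} → Deficient F s → x ∈ X → y ∈ X → key F x ≡ s → key F y ≡ s → x ≡ y
  deficient-≡ {F} {s} {x} {y} deficient x∈ y∈ x~s y~s with <-cmp (level x) (level y)
  ... | tri< x<y _ _ = contradiction (twoPoints x∈ y∈ x~s y~s x<y) deficient
  ... | tri≈ _ x≡y _ = sameLine-level {F} {x} {y} (trans x~s (sym y~s)) x≡y
  ... | tri> _ _ y<x = contradiction (twoPoints y∈ x∈ y~s x~s y<x) deficient

  Lonely : Vec Bool d → V → Set
  Lonely F u = ∀ {y} → y ∈ X → key F y ≡ key F u → y ≡ u

  lonely⇒deficient : ∀ {F u} → Lonely F u → Deficient F (key F u)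
  lonely⇒deficient lonely two with find two
  ... | x , x∈ , x~u , above with find above
  ... | y , y∈ , y~u , x<y = <-irrefl (cong level (trans (lonely x∈ x~u) (sym (lonely y∈ y~u)))) x<y

  Top Bottom : V → Set
  Top u    = ∀ {z} → z ∈ X → column z ≡ column u → level z ≤ level u
  Bottom u = ∀ {z} → z ∈ X → column z ≡ column u → level u ≤ level z

  below⇒top : ∀ {x x′} → x ∈ X → x′ ∈ X → column x′ ≡ column x → level x′ < level x → Top x
  below⇒top {x} {x′} x∈ x′∈ x′≡x x′<x {z} z∈ z≡x = ≮⇒≥ (no-three-on-line {F₀} x′∈ x∈ z∈
    (column⇒sameLine x′ x x′≡x) (column⇒sameLine x z (sym z≡x)) x′<x)

  above⇒bottom : ∀ {x x′} → x ∈ X → x′ ∈ X → column x′ ≡ column x → level x < level x′ → Bottom x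
  above⇒bottom {x} {x′} x∈ x′∈ x′≡x x<x′ {z} z∈ z≡x = ≮⇒≥ λ z<x → no-three-on-line {F₀} z∈ x∈ x′∈
    (column⇒sameLine z x z≡x) (column⇒sameLine x x′ (sym x′≡x)) z<x x<x′

  colleague : ∀ {x} → TwoPoints F₀ (column x) →
    ∃ λ x′ → x′ ∈ X × column x′ ≡ column x × level x′ ≢ level x
  colleague {x} two with find two
  ... | a , a∈ , a~x , above with find above
  ... | b , b∈ , b~x , a<b with level a ≟ level x
  ...   | yes a≡x = b , b∈ , trans (sym (key-F₀ b)) b~x , λ b≡x → <-irrefl (trans a≡x (sym b≡x)) a<b
  ...   | no  a≢x = a , a∈ , trans (sym (key-F₀ a)) a~x , a≢x

  -- slope z u vanishes on the bits from level u on, so above u its line runs inside u's column.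
  lonely-at-top : ∀ {u v} (k : Fin d) → toℕ k ≡ 0 → u ∈ X → v ∈ X → 0 < level u → 0 < level v →
    column v ≡ flipBit k (column u) → Top u → ∃ λ F → Lonely F u
  lonely-at-top {u} {v} k k≡0 u∈ v∈ 0<u 0<v v≡ top with mv u∈ v∈
  ... | w , shortest , clear with find (proj₁ (bit-change⇒crossing k w (flipBit-changes {u} {v} k v≡)))
  ... | z , z∈w , z≡k = slope z u , lonely
    where
    t : V
    t = fzero , column u
    z≡t : level z ≡ level t
    z≡t = trans z≡k k≡0
    up-u = ascendingWalk {t} {u} z≤n (λ _ _ → refl)
    up-v = ascendingWalk {t} {v} z≤n λ where
      i (inj₂ v≤i) → flipBit-keeps {u} {v} k v≡
        (λ i≡k → <⇒≱ 0<v (≤-trans v≤i (≤-reflexive (trans (cong toℕ i≡k) k≡0))))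
    w₁ = prefix w z∈w
    |w₁| : ∣ w₁ ∣ ≡ ∣ reverse (proj₁ up-u) ∣
    |w₁| = shortest-prefix-len shortest z∈w (reverse (proj₁ up-u)) (proj₁ up-v)
      (subst₂ _≤_ (sym (len-reverse (proj₁ up-u))) (len-reverse w₁)
        (ascending-len-≤ (proj₂ up-u) (reverse w₁) (≤-reflexive z≡t) ≤-refl))
      (ascending-len-≤ (proj₂ up-v) (suffix w z∈w) (≤-reflexive z≡t) ≤-refl)
    asc₁ : Ascending (reverse w₁)
    asc₁ = begin
      level z + ∣ reverse w₁ ∣  ≡⟨ cong₂ _+_ z≡t (trans (len-reverse w₁) (trans |w₁| (len-reverse _))) ⟩
      level t + ∣ proj₁ up-u ∣  ≡⟨ proj₂ up-u ⟩
      level u                   ∎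
      where open ≡-Reasoning
    agree₁ : AgreeOutside z u
    agree₁ = ascending⇒agreeOutside {w = reverse w₁} asc₁
    z~u : key (slope z u) z ≡ key (slope z u) u
    z~u = key-slope (≤-trans (≤-reflexive z≡t) z≤n) agree₁
    lonely : Lonely (slope z u) u
    lonely {y} y∈ y~u with level u <? level y
    ... | yes u<y = contradiction (top y∈ (sameLine-column-above y~u (<⇒≤ u<y) flat)) (<⇒≱ u<y)
      where flat = λ i u≤i → slope-flat {z} {u} (agree₁ i (inj₂ u≤i))
    ... | no  u≮y with sameLine-on-visible-path clear (prefix-⊆ w z∈w ∘ ∈-reverse⁻ w₁) asc₁
                         (trans z~u (sym y~u)) y~u (≤-trans (≤-reflexive z≡t) z≤n) (≮⇒≥ u≮y) y∈
    ...   | inj₁ y≡u = y≡u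
    ...   | inj₂ refl = ⊥-elim (flipBit-changes {u} {v} k v≡ (sym (sameLine-below y~u (k< 0<v) (k< 0<u))))
      where
      k< : ∀ {n} → 0 < n → toℕ k < n
      k< = subst (_< _) (sym k≡0)

  lonely-at-bottom : ∀ {u v} (k : Fin d) → suc (toℕ k) ≡ d → u ∈ X → v ∈ X →
    level u < d → level v < d →
    column v ≡ flipBit k (column u) → Bottom u → ∃ λ F → Lonely F u
  lonely-at-bottom {u} {v} k k+1≡d u∈ v∈ u<d v<d v≡ bottom with mv u∈ v∈
  ... | w , shortest , clear with find (proj₂ (bit-change⇒crossing k w (flipBit-changes {u} {v} k v≡)))
  ... | z , z∈w , z≡k+1 = slope u z , lonely
    where
    t : V
    t = fromℕ d , column u
    t≡z : level t ≡ level z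
    t≡z = trans (toℕ-fromℕ d) (sym (trans z≡k+1 k+1≡d))
    ≤t : ∀ x → level x ≤ level t
    ≤t x = subst (level x ≤_) (sym (toℕ-fromℕ d)) (level≤d x)
    up-u = ascendingWalk {u} {t} (≤t u) (λ _ _ → refl)
    up-v = ascendingWalk {v} {t} (≤t v) λ where
      i (inj₁ i<v) → sym (flipBit-keeps {u} {v} k v≡ (λ i≡k →
        <⇒≱ v<d (subst (_≤ level v) (trans (cong (suc ∘ toℕ) i≡k) k+1≡d) i<v)))
      i (inj₂ t≤i) → contradiction (≤-trans (≤-reflexive (sym (toℕ-fromℕ d))) t≤i) (<⇒≱ (toℕ<n i))
    w₁ = prefix w z∈w
    w₂ = suffix w z∈w
    |w₁| : ∣ w₁ ∣ ≡ ∣ proj₁ up-u ∣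
    |w₁| = shortest-prefix-len shortest z∈w (proj₁ up-u) (reverse (proj₁ up-v))
      (ascending-len-≤ (proj₂ up-u) w₁ ≤-refl (≤-reflexive t≡z))
      (subst₂ _≤_ (sym (len-reverse (proj₁ up-v))) (len-reverse w₂)
        (ascending-len-≤ (proj₂ up-v) (reverse w₂) ≤-refl (≤-reflexive t≡z)))
    asc₁ : Ascending w₁
    asc₁ = trans (cong (level u +_) |w₁|) (trans (proj₂ up-u) t≡z)
    agree₁ : AgreeOutside u z
    agree₁ = ascending⇒agreeOutside {w = w₁} asc₁
    u~z : key (slope u z) u ≡ key (slope u z) z
    u~z = key-slope (≤-trans (≤t u) (≤-reflexive t≡z)) agree₁
    lonely : Lonely (slope u z) u
    lonely {y} y∈ y~u with level y <? level u
    ... | yes y<u = contradiction (bottom y∈ (sameLine-column-below y~u (<⇒≤ y<u) flat)) (<⇒≱ y<u)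
      where flat = λ i i<u → slope-flat {u} {z} (agree₁ i (inj₁ i<u))
    ... | no  y≮u with sameLine-on-visible-path clear (prefix-⊆ w z∈w) asc₁
                         (sym y~u) (trans y~u u~z) (≮⇒≥ y≮u) (≤-trans (≤t y) (≤-reflexive t≡z)) y∈
    ...   | inj₁ y≡u = y≡u
    ...   | inj₂ refl = ⊥-elim (flipBit-changes {u} {v} k v≡ (sym (sameLine-above y~u (≤k v<d) (≤k u<d))))
      where
      ≤k : ∀ {n} → n < d → n ≤ toℕ k
      ≤k n<d = ≤-pred (subst (_ <_) (sym k+1≡d) n<d)

module TwoDeficientLines (d : ℕ) {X : List (BFVertex d)} (uniq : Unique X) (mv : MutualVisibility (BFAdj d) X) where

  open Butterfly d
  open Visibility d mv

  module _ (F : Vec Bool d) where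

    data Rank (x : V) : Vec Bool (suc d) → Set where
      upper  : ∀ {s y} → key F x ≡ s → y ∈ X → key F y ≡ s → level y < level x → Rank x (true ∷ s)
      lowest : ∀ {s} → key F x ≡ s → (∀ {y} → y ∈ X → key F y ≡ s → level x ≤ level y) →
               Rank x (false ∷ s)

    rank : ∀ {x} → x ∈ X → ∃ (Rank x)
    rank {x} x∈ with any? (λ y → (key F y ≟ᶜ key F x) ×-dec (level y <? level x)) X
    ... | yes below = let (y , y∈ , y~x , y<x) = find below in true ∷ key F x , upper refl y∈ y~x y<x
    ... | no  none  = false ∷ key F x , lowest refl (λ y∈ y~x → ≮⇒≥ (λ y<x → none (lose y∈ (y~x , y<x))))

    rank-injective : ∀ {x y r} → x ∈ X → y ∈ X → Rank x r → Rank y r → x ≡ y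
    rank-injective {x} {y} x∈ y∈ (lowest x~s x-lowest) (lowest y~s y-lowest) =
      sameLine-level {F} {x} {y} (trans x~s (sym y~s)) (≤-antisym (x-lowest y∈ y~s) (y-lowest x∈ x~s))
    rank-injective {x} {y} x∈ y∈ (upper x~s x₀∈ x₀~s x₀<x) (upper y~s y₀∈ y₀~s y₀<y)
      with <-cmp (level x) (level y)
    ... | tri< x<y _ _ =
      ⊥-elim (no-three-on-line x₀∈ x∈ y∈ (trans x₀~s (sym x~s)) (trans x~s (sym y~s)) x₀<x x<y)
    ... | tri≈ _ x≡y _ = sameLine-level {F} {x} {y} (trans x~s (sym y~s)) x≡y
    ... | tri> _ _ y<x =
      ⊥-elim (no-three-on-line y₀∈ y∈ x∈ (trans y₀~s (sym y~s)) (trans y~s (sym x~s)) y₀<y y<x)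

    upper⇒twoPoints : ∀ {x s} → x ∈ X → Rank x (true ∷ s) → TwoPoints F s
    upper⇒twoPoints x∈ (upper x~s y∈ y~s y<x) = twoPoints y∈ x∈ y~s x~s y<x

  two-deficient⇒bound : ∀ {F s t} → s ≢ t → Deficient F s → Deficient F t → length X + 2 ≤ 2 * 2 ^ d
  two-deficient⇒bound {F} {s} {t} s≢t deficient-s deficient-t = subst (length X + 2 ≤_) (length-allVecs (suc d))
    (injective-labelling⇒length≤ uniq (((s≢t ∘ Vec.∷-injectiveʳ) ∷ []) ∷ [] ∷ []) ∈-allVecs
      (rank F) (rank-injective F) unused)
    where
    unused : ∀ {x r} → x ∈ X → Rank F x r → r ∉ (true ∷ s) ∷ (true ∷ t) ∷ []
    unused x∈ rank (here refl)         = deficient-s (upper⇒twoPoints F x∈ rank)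
    unused x∈ rank (there (here refl)) = deficient-t (upper⇒twoPoints F x∈ rank)

module AtMostOneDeficientLine (n : ℕ) {X : List (BFVertex (suc n))} (uniq : Unique X)
  (mv : MutualVisibility (BFAdj (suc n)) X)
  (one-deficient : ∀ {F s t} → Visibility.Deficient (suc n) mv F s → Visibility.Deficient (suc n) mv F t → s ≡ t)
  where

  private
    d = suc n
  open Butterfly d
  open Visibility d mv

  first last : Fin d
  first = fzero
  last  = fromℕ n

  data Certificate (x : V) : Vec Bool d ⊎ Bool → Set where
    onDeficientLine       : ∀ {F} → Deficient F (key F x) → Certificate x (inj₁ F)
    topBesideDeficient    : Deficient F₀ (flipBit first (column x)) → Top x → Certificate x (inj₂ true)
    bottomBesideDeficient : Deficient F₀ (flipBit last (column x)) → Bottom x → Certificate x (inj₂ false)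

  certify-top : ∀ {x} → x ∈ X → Top x → 0 < level x → ∃ (Certificate x)
  certify-top {x} x∈ top 0<x with twoPoints? F₀ (flipBit first (column x))
  ... | no  deficient = inj₂ true , topBesideDeficient deficient top
  ... | yes two with find two
  ... | y₁ , y₁∈ , y₁~c , above with find above
  ... | y₂ , y₂∈ , y₂~c , y₁<y₂ =
    let (F , lonely) = lonely-at-top first refl x∈ y₂∈ 0<x (<-≤-trans (s≤s z≤n) y₁<y₂)
                         (trans (sym (key-F₀ y₂)) y₂~c) top
    in inj₁ F , onDeficientLine (lonely⇒deficient lonely)

  certify-bottom : ∀ {x} → x ∈ X → Bottom x → level x < d → ∃ (Certificate x)
  certify-bottom {x} x∈ bottom x<d with twoPoints? F₀ (flipBit last (column x))
  ... | no  deficient = inj₂ false , bottomBesideDeficient deficient bottom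
  ... | yes two with find two
  ... | y₁ , y₁∈ , y₁~c , above with find above
  ... | y₂ , y₂∈ , y₂~c , y₁<y₂ =
    let (F , lonely) = lonely-at-bottom last (cong suc (toℕ-fromℕ n)) x∈ y₁∈ x<d
                         (<-≤-trans y₁<y₂ (level≤d y₂)) (trans (sym (key-F₀ y₁)) y₁~c) bottom
    in inj₁ F , onDeficientLine (lonely⇒deficient lonely)

  certify : ∀ {x} → x ∈ X → ∃ (Certificate x)
  certify {x} x∈ with twoPoints? F₀ (column x)
  ... | no  deficient = inj₁ F₀ , onDeficientLine (subst (Deficient F₀) (sym (key-F₀ x)) deficient)
  ... | yes two with colleague two
  ... | x′ , x′∈ , x′≡x , x′≢x with <-cmp (level x′) (level x)
  ...   | tri< x′<x _ _ = certify-top x∈ (below⇒top x∈ x′∈ x′≡x x′<x) (<-≤-trans (s≤s z≤n) x′<x)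
  ...   | tri≈ _ x′≡x _ = contradiction x′≡x x′≢x
  ...   | tri> _ _ x<x′ =
    certify-bottom x∈ (above⇒bottom x∈ x′∈ x′≡x x<x′) (<-≤-trans x<x′ (level≤d x′))

  certificate-injective : ∀ {x y c} → x ∈ X → y ∈ X → Certificate x c → Certificate y c → x ≡ y
  certificate-injective x∈ y∈ (onDeficientLine dx) (onDeficientLine dy) =
    deficient-≡ dx x∈ y∈ refl (one-deficient dy dx)
  certificate-injective x∈ y∈ (topBesideDeficient dx top-x) (topBesideDeficient dy top-y) =
    vertex-≡ (≤-antisym (top-y x∈ x≡y) (top-x y∈ (sym x≡y))) x≡y
    where x≡y = flipBit-injective first (one-deficient dx dy)
  certificate-injective x∈ y∈ (bottomBesideDeficient dx bottom-x) (bottomBesideDeficient dy bottom-y) =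
    vertex-≡ (≤-antisym (bottom-x y∈ (sym x≡y)) (bottom-y x∈ x≡y)) x≡y
    where x≡y = flipBit-injective last (one-deficient dx dy)

  labels : List (Vec Bool d ⊎ Bool)
  labels = inj₂ true ∷ inj₂ false ∷ map inj₁ (allVecs d)

  ∈-labels : ∀ c → c ∈ labels
  ∈-labels (inj₁ F)     = there (there (∈-map⁺ inj₁ (∈-allVecs F)))
  ∈-labels (inj₂ true)  = here refl
  ∈-labels (inj₂ false) = there (here refl)

  one-deficient⇒bound : length X ≤ 2 + 2 ^ d
  one-deficient⇒bound = begin
    length X       ≡⟨ sym (+-identityʳ (length X)) ⟩
    length X + 0   ≤⟨ injective-labelling⇒length≤ uniq [] ∈-labels certify certificate-injective (λ _ _ ()) ⟩
    length labels  ≡⟨ cong (2 +_) (trans (length-map inj₁ (allVecs d)) (length-allVecs d)) ⟩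
    2 + 2 ^ d      ∎
    where open ≤-Reasoning

butterfly-bound : ∀ n {X : List (BFVertex (suc (suc n)))} → Unique X → MutualVisibility (BFAdj (suc (suc n))) X →
  length X + 2 ≤ 2 * 2 ^ suc (suc n)
butterfly-bound n {X} uniq mv with length X + 2 ≤? 2 * 2 ^ suc (suc n)
... | yes bound = bound
... | no  ¬bound = contradiction (doubling 4≤2^d one-deficient-bound) ¬bound
  where
  d = suc (suc n)
  open Butterfly d using (_≟ᶜ_)
  open Visibility d mv using (Deficient)
  one-deficient : ∀ {F s t} → Deficient F s → Deficient F t → s ≡ t
  one-deficient {s = s} {t} deficient-s deficient-t with s ≟ᶜ t
  ... | yes s≡t = s≡t
  ... | no  s≢t = contradiction (TwoDeficientLines.two-deficient⇒bound d uniq mv s≢t deficient-s deficient-t) ¬bound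
  one-deficient-bound : length X ≤ 2 + 2 ^ d
  one-deficient-bound = AtMostOneDeficientLine.one-deficient⇒bound (suc n) uniq mv one-deficient
  4≤2^d : 4 ≤ 2 ^ d
  4≤2^d = *-monoʳ-≤ 2 (*-monoʳ-≤ 2 (m^n>0 2 n))
  doubling : ∀ {l m} → 4 ≤ m → l ≤ 2 + m → l + 2 ≤ 2 * m
  doubling {l} {m} 4≤m l≤2+m = begin
    l + 2      ≤⟨ +-monoˡ-≤ 2 l≤2+m ⟩
    2 + m + 2  ≡⟨ +-comm (2 + m) 2 ⟩
    4 + m      ≡⟨ +-comm 4 m ⟩
    m + 4      ≤⟨ +-monoʳ-≤ m 4≤m ⟩
    m + m      ≡⟨ cong (m +_) (sym (+-identityʳ m)) ⟩
    2 * m      ∎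
    where open ≤-Reasoning

lemma8 : (d : ℕ) → 2 ≤ d → (X : List (BFVertex d)) → Unique X →
         MutualVisibility (BFAdj d) X → length X ≤ 2 ^ (d + 1) ∸ 2
lemma8 (suc (suc n)) _ X uniq mv = m+n≤o⇒m≤o∸n (length X)
  (subst (length X + 2 ≤_) (cong (2 ^_) (+-comm 1 (suc (suc n)))) (butterfly-bound n uniq mv))
lemma8 1 (s≤s ())
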